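{- Let $n\ge 4$ and let $G_n = K_{n,\binom{n}{2}}$ be the complete bipartite graph with parts of sizes $n$ and $\binom{n}{2}$. Let $\widehat{S(G_n)}$ be the graph obtained from the subdivision graph $S(G_n)$ (each edge of $G_n$ subdivided exactly once) by adding an edge between every two distinct vertices of $V(S(G_n))\setminus V(G_n)$. Then $\mathrm{sgc}\big(\widehat{S(G_n)}\big) = n$.
   Context: For a graph $G$ and $S\subseteq V(G)$, one fixes for each unordered pair $\{x,y\}$ of distinct vertices of $S$ a single shortest $x,y$-path $\widetilde g(x,y)$; $S$ is a strong geodetic set if for some such choice the union of the vertex sets of the chosen paths equals $V(G)$. $\mathrm{sg}(G)$ is the minimum size of a strong geodetic set; a minimum one is an sg-set. For a strong geodetic set $S$, a set $X\subseteq S$ is a strong geodetic core for $S$ if there exists a choice of fixed shortest paths $\widetilde g(x,y)$ for pairs of $S$ such that $\bigcup_{(u,v)\in X\times S} V(\widetilde g(u,v)) = V(G)$. $\mathrm{sgc}(S)$ is the minimum size of a strong geodetic core for $S$, and $\mathrm{sgc}(G)=\min\{\mathrm{sgc}(S): S \text{ an sg-set of } G\}$. -}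

module Defs where

open import Data.Nat as ℕ using (ℕ; zero; suc; _≤_; _<_)
open import Data.Nat.Combinatorics using (_C_)
open import Data.Fin as Fin using (Fin; toℕ; splitAt; remQuot)
open import Data.Fin.Subset using (Subset; _∈_; _⊆_; ∣_∣)
open import Data.List using (List; []; _∷_)
import Data.List.Membership.Propositional as LM
open import Data.Product using (Σ; ∃; ∃-syntax; _×_; _,_)
open import Data.Sum using (_⊎_; inj₁; inj₂)
open import Data.Empty using (⊥)
open import Relation.Nullary using (¬_)
open import Relation.Binary.PropositionalEquality using (_≡_)

record Graph : Set₁ where
  field
    N   : ℕ
    Adj : Fin N → Fin N → Set

module _ (G : Graph) where
  open Graph G

  data Walk : Fin N → Fin N → ℕ → Set where
    here : ∀ {x} → Walk x x 0
    step : ∀ {x z y k} → Adj x z → Walk z y k → Walk x y (suc k)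

  verts : ∀ {x y k} → Walk x y k → List (Fin N)
  verts (here {x})        = x ∷ []
  verts (step {x} _ w)    = x ∷ verts w

  Geodesic : Fin N → Fin N → Set
  Geodesic x y = Σ ℕ λ k → Σ (Walk x y k) λ _ → ∀ k' → Walk x y k' → k ≤ k'

  geoVerts : ∀ {x y} → Geodesic x y → List (Fin N)
  geoVerts (_ , w , _) = verts w

  -- A choice of one fixed shortest path g̃(x,y) for each unordered pair {x,y}
  -- of distinct vertices of S.  The pair {x,y} is represented by its ordered
  -- version with toℕ x < toℕ y; the choice on pairs outside S is irrelevant.
  record PathChoice (S : Subset N) : Set where
    field
      path : (x y : Fin N) → toℕ x < toℕ y → x ∈ S → y ∈ S → Geodesic x y

  open PathChoice public

  OnPath : ∀ {S} → PathChoice S → (u v w : Fin N) → u ∈ S → v ∈ S → Set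
  OnPath c u v w uS vS =
      (Σ (toℕ u < toℕ v) λ h → w LM.∈ geoVerts (path c u v h uS vS))
    ⊎ (Σ (toℕ v < toℕ u) λ h → w LM.∈ geoVerts (path c v u h vS uS))

  Covers : ∀ {S} → PathChoice S → Subset N → Set
  Covers {S} c X = ∀ w → ∃[ u ] ∃[ v ] Σ (u ∈ X) λ _ → Σ (u ∈ S) λ uS → Σ (v ∈ S) λ vS →
                     OnPath c u v w uS vS

  IsStrongGeodeticSet : Subset N → Set
  IsStrongGeodeticSet S = Σ (PathChoice S) λ c → Covers c S

  IsSgSet : Subset N → Set
  IsSgSet S = IsStrongGeodeticSet S × (∀ S' → IsStrongGeodeticSet S' → ∣ S ∣ ≤ ∣ S' ∣)

  IsStrongGeodeticCore : Subset N → Subset N → Set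
  IsStrongGeodeticCore S X = X ⊆ S × Σ (PathChoice S) λ c → Covers c X

  -- sgc(G) = k : k = min { sgc(S) : S an sg-set }, with sgc(S) the minimum
  -- size of a strong geodetic core for S.  Unfolded: some sg-set has a core of
  -- size k, and every core of every sg-set has size ≥ k.
  SgcEq : ℕ → Set
  SgcEq k = (∃[ S ] ∃[ X ] (IsSgSet S × IsStrongGeodeticCore S X × ∣ X ∣ ≡ k))
          × (∀ S X → IsSgSet S → IsStrongGeodeticCore S X → k ≤ ∣ X ∣)

-- vertices: a i (part of size n), b j (part of size m = n C 2),
-- s i j (subdivision vertex of the edge a i – b j)
data Kind (n m : ℕ) : Set where
  a : Fin n → Kind n m
  b : Fin m → Kind n m
  s : Fin n → Fin m → Kind n m

KAdj : ∀ {n m} → Kind n m → Kind n m → Set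
KAdj (a i)   (s i' j)  = i ≡ i'
KAdj (s i' j) (a i)    = i ≡ i'
KAdj (b j)   (s i j')  = j ≡ j'
KAdj (s i j') (b j)    = j ≡ j'
KAdj (s i j) (s i' j') = ¬ (i ≡ i' × j ≡ j')
KAdj _ _ = ⊥

numVerts : ℕ → ℕ → ℕ
numVerts n m = (n ℕ.+ m) ℕ.+ n ℕ.* m

kind : ∀ n m → Fin (numVerts n m) → Kind n m
kind n m x with splitAt (n ℕ.+ m) x
... | inj₂ e with remQuot m e
...   | i , j = s i j
kind n m x | inj₁ v with splitAt n v
...   | inj₁ i = a i
...   | inj₂ j = b j

SubdivHat : ℕ → ℕ → Graph
SubdivHat n m = record
  { N   = numVerts n m
  ; Adj = λ x y → KAdj (kind n m x) (kind n m y) }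

HatSG : ℕ → Graph
HatSG n = SubdivHat n (n C 2)

module Submission where

open import Defs
open import Data.Nat using (ℕ; _≤_)
open import Data.Nat using (suc; s≤s)
open import Data.Nat.Properties using (≤-trans)
open import Data.Nat.Combinatorics using (_C_)
open import Data.Fin as Fin using (Fin; fromℕ<)
open import Data.Fin.Subset using (∣_∣)
open import Data.Product using (_,_)

-- Call a, b the branch vertices (those of K_{n,m}, m = C(n,2)) and s the
-- subdivision vertices, which form a clique.  The neighbourhood of a branch
-- vertex is a clique, so no geodesic passes through it; hence every strong
-- geodetic set contains all n + m branch vertices, and since these already
-- form one, the sg-sets are exactly {all branch vertices}.
--
-- Upper bound: with the chosen paths a_i s_ij b_j (and paths of length 3
-- inside a side), the n vertices a_i alone cover everything.
-- Lower bound: let a core X contain p of the a's and q of the b's, missing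
-- r and c of them.  Every geodesic between branch vertices is written out
-- explicitly, and one checks that each s_ij with a_i, b_j ∉ X is covered by a
-- pair (a_r', a_i) or (b_c', b_j) starting in X, different s_ij by different
-- pairs.  So r·c ≤ p·r + q·c, which for p + r = n, q + c = C(n,2), n ≥ 4
-- forces p + q ≥ n.

module Counting where

  open import Data.Nat using (suc; _+_; _*_; _≤_; z≤n; s≤s)
  open import Data.Nat.Properties using (≤-trans; +-suc)
  open import Data.Fin using (Fin) renaming (zero to fzero; suc to fsuc)
  open import Data.Fin.Subset using (Subset; ∣_∣; inside; outside) renaming (_∈_ to _∈ₛ_)
  open import Data.Vec.Base using ([]; _∷_; here; there)
  import Data.Vec.Base as Vec
  open import Data.List using (List; []; _∷_; length; map; filter; cartesianProduct; allFin; _++_)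
  open import Data.List.Properties using (length-++; length-map; length-tabulate; filter-notAll)
  open import Data.List.Relation.Unary.Any as Any using (here; there)
  open import Data.List.Relation.Unary.All as All using (All)
  open import Data.List.Relation.Unary.AllPairs using (_∷_)
  open import Data.List.Relation.Unary.Unique.Propositional using (Unique)
  open import Data.List.Membership.Propositional using (_∈_)
  open import Data.List.Membership.Propositional.Properties using (∈-filter⁺; ∈-map⁺)
  open import Data.Product using (_,_)
  open import Relation.Binary using (DecidableEquality)
  open import Relation.Binary.PropositionalEquality
  open import Relation.Nullary using (yes; no; ¬?)
  open import Relation.Unary using (Decidable)

  length-cartesianProduct : ∀ {A B : Set} (xs : List A) (ys : List B) →
                            length (cartesianProduct xs ys) ≡ length xs * length ys
  length-cartesianProduct []       ys = refl
  length-cartesianProduct (x ∷ xs) ys = begin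
    length (map (x ,_) ys ++ cartesianProduct xs ys)         ≡⟨ length-++ (map (x ,_) ys) ⟩
    length (map (x ,_) ys) + length (cartesianProduct xs ys) ≡⟨ cong₂ _+_ (length-map (x ,_) ys)
                                                                          (length-cartesianProduct xs ys) ⟩
    length ys + length xs * length ys                         ∎
    where open ≡-Reasoning

  length-filter-split : ∀ {A : Set} {P : A → Set} (P? : Decidable P) (xs : List A) →
                        length (filter P? xs) + length (filter (λ x → ¬? (P? x)) xs) ≡ length xs
  length-filter-split P? []       = refl
  length-filter-split P? (x ∷ xs) with P? x
  ... | yes _ = cong suc (length-filter-split P? xs)
  ... | no  _ = trans (+-suc _ _) (cong suc (length-filter-split P? xs))

  length-filter-allFin : ∀ {k} {P : Fin k → Set} (P? : Decidable P) →
                         length (filter P? (allFin k)) + length (filter (λ i → ¬? (P? i)) (allFin k)) ≡ k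
  length-filter-allFin {k} P? = trans (length-filter-split P? (allFin k)) (length-tabulate (λ i → i))

  -- Counting by injection: a map that is injective on a duplicate-free list xs
  -- and sends xs into ys shows length xs ≤ length ys.  Each step removes the
  -- image of the head from ys.
  injection-length : ∀ {A B : Set} → DecidableEquality B → (f : A → B) {xs : List A} {ys : List B} →
                     Unique xs →
                     (∀ {x y} → x ∈ xs → y ∈ xs → f x ≡ f y → x ≡ y) →
                     (∀ {x} → x ∈ xs → f x ∈ ys) →
                     length xs ≤ length ys
  injection-length _≟_ f {[]}     _              _   _    = z≤n
  injection-length _≟_ f {x ∷ xs} {ys} (x∉xs ∷ unique) inj into =
    ≤-trans (s≤s (injection-length _≟_ f unique (λ p q → inj (there p) (there q)) into-rest))
            (filter-notAll other? ys (Any.map (λ fx≡y y≢fx → y≢fx (sym fx≡y)) (into (here refl))))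
    where
    other? : Decidable (λ y → y ≢ f x)
    other? y = ¬? (y ≟ f x)
    into-rest : ∀ {y} → y ∈ xs → f y ∈ filter other? ys
    into-rest y∈xs = ∈-filter⁺ other? (into (there y∈xs))
                       (λ fy≡fx → All.lookup x∉xs y∈xs (inj (here refl) (there y∈xs) (sym fy≡fx)))

  members : ∀ {k} → Subset k → List (Fin k)
  members []              = []
  members (inside  ∷ p) = fzero ∷ map fsuc (members p)
  members (outside ∷ p) = map fsuc (members p)

  length-members : ∀ {k} (p : Subset k) → length (members p) ≡ ∣ p ∣
  length-members []            = refl
  length-members (inside  ∷ p) = cong suc (trans (length-map fsuc (members p)) (length-members p))
  length-members (outside ∷ p) = trans (length-map fsuc (members p)) (length-members p)

  ∈-members : ∀ {k} {p : Subset k} {x} → x ∈ₛ p → x ∈ members p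
  ∈-members {p = inside  ∷ p} here          = here refl
  ∈-members {p = inside  ∷ p} (there x∈p)   = there (∈-map⁺ fsuc (∈-members x∈p))
  ∈-members {p = outside ∷ p} (there x∈p)   = ∈-map⁺ fsuc (∈-members x∈p)

  ∣++∣ : ∀ {k l} (p : Subset k) (q : Subset l) → ∣ p Vec.++ q ∣ ≡ ∣ p ∣ + ∣ q ∣
  ∣++∣ []            q = refl
  ∣++∣ (inside  ∷ p) q = cong suc (∣++∣ p q)
  ∣++∣ (outside ∷ p) q = ∣++∣ p q

module Arithmetic where

  open import Data.Nat
  open import Data.Nat.Properties
  open import Data.Nat.Combinatorics using (_C_; nCk+nC[k+1]≡[n+1]C[k+1]; nC1≡n)
  open import Data.Nat.Tactic.RingSolver using (solve-∀)
  open import Data.Empty using (⊥; ⊥-elim)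
  open import Relation.Binary.PropositionalEquality
  open import Relation.Nullary using (yes; no)

  -- Pascal's rule at k = 1 gives the closed form 2·C(n+1,2) = (n+1)·n.
  twice-C2 : ∀ n → 2 * (suc n C 2) ≡ suc n * n
  twice-C2 zero    = refl
  twice-C2 (suc n) = begin
    2 * (suc (suc n) C 2)              ≡⟨ cong (2 *_) (sym (nCk+nC[k+1]≡[n+1]C[k+1] (suc n) 1)) ⟩
    2 * (suc n C 1 + suc n C 2)        ≡⟨ *-distribˡ-+ 2 (suc n C 1) (suc n C 2) ⟩
    2 * (suc n C 1) + 2 * (suc n C 2)  ≡⟨ cong₂ _+_ (cong (2 *_) (nC1≡n (suc n))) (twice-C2 n) ⟩
    2 * suc n + suc n * n              ≡⟨ expand n ⟩
    suc (suc n) * suc n                ∎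
    where
    open ≡-Reasoning
    expand : ∀ n → 2 * suc n + suc n * n ≡ suc (suc n) * suc n
    expand = solve-∀

  -- C(n,2) > 0 for n ≥ 2, so the second side of K_{n,C(n,2)} is nonempty.
  C2-positive : ∀ k → 0 < suc (suc k) C 2
  C2-positive k with suc (suc k) C 2 | twice-C2 (suc k)
  ... | suc _ | _ = s≤s z≤n

  n≤n*n : ∀ n → n ≤ n * n
  n≤n*n zero    = z≤n
  n≤n*n (suc n) = m≤m*n (suc n) (suc n)

  n<n*n : ∀ n → 2 ≤ n → n < n * n
  n<n*n (suc n) 2≤n = m<m*n (suc n) (suc n) 2≤n

  -- x + y < x² + y² as soon as x + y ≥ 3 (the exceptions all have x, y ≤ 1).
  sum<squares : ∀ x y → 3 ≤ x + y → x + y < x * x + y * y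
  sum<squares x@(suc (suc _)) y _ = +-mono-<-≤ (n<n*n x (s≤s (s≤s z≤n))) (n≤n*n y)
  sum<squares x y@(suc (suc _)) _ = +-mono-≤-< (n≤n*n x) (n<n*n y (s≤s (s≤s z≤n)))
  sum<squares 0 0 ()
  sum<squares 0 1 (s≤s ())
  sum<squares 1 0 (s≤s ())
  sum<squares 1 1 (s≤s (s≤s ()))

  -- With r = t + 1 and n = p + r ≥ 4, the value t + p·r stays below C(n,2).
  below-C2 : ∀ p t → 3 ≤ p + t → 2 * (t + p * suc t) < 2 * (suc (p + t) C 2)
  below-C2 p t 3≤p+t = begin-strict
    2 * (t + p * suc t)  <⟨ +-cancelʳ-< (p + t) _ _ shifted ⟩
    suc (p + t) * (p + t) ≡⟨ sym (twice-C2 (p + t)) ⟩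
    2 * (suc (p + t) C 2) ∎
    where
    open ≤-Reasoning
    identity : ∀ p t → 2 * (t + p * suc t) + (p * p + t * t) ≡ suc (p + t) * (p + t) + (p + t)
    identity = solve-∀
    shifted : 2 * (t + p * suc t) + (p + t) < suc (p + t) * (p + t) + (p + t)
    shifted = <-≤-trans (+-monoʳ-< (2 * (t + p * suc t)) (sum<squares p t 3≤p+t)) (≤-reflexive (identity p t))

  -- From r·c ≤ p·r + q·c and q < r: (q+1)·c ≤ r·c, so c ≤ p·r.
  cancel-column : ∀ p q r c → q < r → r * c ≤ p * r + q * c → c ≤ p * r
  cancel-column p q r c q<r count = +-cancelʳ-≤ (q * c) c (p * r)
    (≤-trans (*-monoˡ-≤ c q<r) count)

  core-bound : ∀ {n} p q r c → 4 ≤ n → p + r ≡ n → q + c ≡ n C 2 →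
               r * c ≤ p * r + q * c → n ≤ p + q
  core-bound p q r c 4≤n refl q+c≡m count with p + r ≤? p + q
  ... | yes n≤p+q = n≤p+q
  ... | no  n≰p+q = ⊥-elim (no-room r (+-cancelˡ-< p q r (≰⇒> n≰p+q)) 4≤n q+c≡m count)
    where
    no-room : ∀ r → q < r → 4 ≤ p + r → q + c ≡ (p + r) C 2 → r * c ≤ p * r + q * c → ⊥
    no-room (suc t) (s≤s q≤t) 4≤n q+c≡m count = <-irrefl refl (begin-strict
      2 * (suc (p + t) C 2)  ≡⟨ cong (λ k → 2 * (k C 2)) (sym (+-suc p t)) ⟩
      2 * ((p + suc t) C 2)  ≡⟨ cong (2 *_) (sym q+c≡m) ⟩
      2 * (q + c)            ≤⟨ *-monoʳ-≤ 2 (+-mono-≤ q≤t (cancel-column p q (suc t) c (s≤s q≤t) count)) ⟩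
      2 * (t + p * suc t)    <⟨ below-C2 p t (≤-pred (subst (4 ≤_) (+-suc p t) 4≤n)) ⟩
      2 * (suc (p + t) C 2)  ∎)
      where open ≤-Reasoning

module GraphFacts (G : Graph) where

  open Graph G
  open import Data.Nat using (suc; _≤_; _<_; z≤n; s≤s)
  open import Data.Nat.Properties using (≤-refl; n≤1+n; ≤-antisym; <⇒≱; <-irrefl; <-asym; <-irrelevant; <-cmp)
  open import Data.Fin using (Fin; toℕ; _≟_)
  open import Data.Fin.Properties using (toℕ-injective)
  open import Data.Fin.Subset using (Subset; _⊆_) renaming (_∈_ to _∈ₛ_)
  open import Data.List using (List; []; _∷_)
  open import Data.List.Relation.Unary.Any using (here; there)
  open import Data.List.Membership.Propositional using (_∈_)
  open import Data.Product using (Σ-syntax; ∃-syntax; _×_; _,_; proj₁)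
  open import Data.Sum using (_⊎_; inj₁; inj₂; swap)
  open import Data.Empty using (⊥; ⊥-elim)
  open import Relation.Binary using (tri<; tri≈; tri>)
  open import Relation.Binary.PropositionalEquality
  open import Relation.Nullary using (¬_; yes; no)

  start∈verts : ∀ {x y k} (p : Walk G x y k) → x ∈ verts G p
  start∈verts here       = here refl
  start∈verts (step _ _) = here refl

  end∈verts : ∀ {x y k} (p : Walk G x y k) → y ∈ verts G p
  end∈verts here       = here refl
  end∈verts (step _ p) = there (end∈verts p)

  walk≥2 : ∀ {x y k} → x ≢ y → ¬ Adj x y → Walk G x y k → 2 ≤ k
  walk≥2 x≢y _   here                = ⊥-elim (x≢y refl)
  walk≥2 _   ¬xy (step xy here)      = ⊥-elim (¬xy xy)
  walk≥2 _   _   (step _ (step _ _)) = s≤s (s≤s z≤n)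

  walk≥3 : ∀ {x y k} → x ≢ y → ¬ Adj x y → (∀ {z} → Adj x z → Adj z y → ⊥) → Walk G x y k → 3 ≤ k
  walk≥3 x≢y _   _       here                         = ⊥-elim (x≢y refl)
  walk≥3 _   ¬xy _       (step xy here)               = ⊥-elim (¬xy xy)
  walk≥3 _   _   ¬common (step xz (step zy here))     = ⊥-elim (¬common xz zy)
  walk≥3 _   _   _       (step _ (step _ (step _ _))) = s≤s (s≤s (s≤s z≤n))

  geodesic : ∀ {x y d} → Walk G x y d → (∀ {k} → Walk G x y k → d ≤ k) → Geodesic G x y
  geodesic p shortest = _ , p , λ _ → shortest

  geodesic-length : ∀ {x y d} → Walk G x y d → (∀ {k} → Walk G x y k → d ≤ k) →
                    (g : Geodesic G x y) → proj₁ g ≡ d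
  geodesic-length p shortest (_ , q , minimal) = ≤-antisym (minimal _ p) (shortest q)

  two-step : ∀ {x y} (g : Geodesic G x y) → proj₁ g ≡ 2 →
             ∃[ z ] Adj x z × Adj z y × geoVerts G g ≡ x ∷ z ∷ y ∷ []
  two-step (_ , step xz (step zy here) , _) refl = _ , xz , zy , refl

  three-step : ∀ {x y} (g : Geodesic G x y) → proj₁ g ≡ 3 →
               ∃[ z₁ ] ∃[ z₂ ] Adj x z₁ × Adj z₂ y × geoVerts G g ≡ x ∷ z₁ ∷ z₂ ∷ y ∷ []
  three-step (_ , step xz₁ (step _ (step z₂y here)) , _) refl = _ , _ , xz₁ , z₂y , refl

  Simplicial : Fin N → Set
  Simplicial w = ∀ {u v} → Adj u w → Adj w v → u ≡ v ⊎ Adj u v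

  -- A walk u → w → v through a simplicial vertex w can be shortened by
  -- skipping w, so an x,y-walk through a simplicial w ∉ {x, y} is not shortest.
  bypass : ∀ {x w y k} → Adj x w → Walk G w y k → w ≢ y → Simplicial w →
           ∃[ k' ] k' < suc k × Walk G x y k'
  bypass _  here         w≢y _          = ⊥-elim (w≢y refl)
  bypass xw (step wv p) _   simplicial with simplicial xw wv
  ... | inj₁ refl = _ , s≤s (n≤1+n _) , p
  ... | inj₂ xv   = _ , ≤-refl , step xv p

  shortcut : ∀ {x y w k} (p : Walk G x y k) → w ∈ verts G p → w ≢ x → w ≢ y → Simplicial w →
             ∃[ k' ] k' < k × Walk G x y k'
  shortcut here        (here w≡x) w≢x _ _ = ⊥-elim (w≢x w≡x)
  shortcut (step _ _)  (here w≡x) w≢x _ _ = ⊥-elim (w≢x w≡x)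
  shortcut {w = w} (step {z = z} xz p) (there w∈p) _ w≢y simplicial with w ≟ z
  ... | yes refl = bypass xz p w≢y simplicial
  ... | no  w≢z  with shortcut p w∈p w≢z w≢y simplicial
  ...   | k' , k'<k , q = suc k' , s≤s k'<k , step xz q

  simplicial-endpoint : ∀ {x y w} (g : Geodesic G x y) → w ∈ geoVerts G g → Simplicial w → w ≡ x ⊎ w ≡ y
  simplicial-endpoint {x} {y} {w} (_ , p , minimal) w∈p simplicial with w ≟ x | w ≟ y
  ... | yes w≡x | _       = inj₁ w≡x
  ... | no  _   | yes w≡y = inj₂ w≡y
  ... | no  w≢x | no  w≢y with shortcut p w∈p w≢x w≢y simplicial
  ...   | k' , k'<k , q = ⊥-elim (<⇒≱ k'<k (minimal k' q))

  -- A geodesic between u and v read in either direction, as a chosen path is.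
  BiGeodesic : Fin N → Fin N → Set
  BiGeodesic u v = Geodesic G u v ⊎ Geodesic G v u

  biVerts : ∀ {u v} → BiGeodesic u v → List (Fin N)
  biVerts (inj₁ g) = geoVerts G g
  biVerts (inj₂ g) = geoVerts G g

  bi-simplicial-endpoint : ∀ {u v w} (g : BiGeodesic u v) → w ∈ biVerts g → Simplicial w → w ≡ u ⊎ w ≡ v
  bi-simplicial-endpoint (inj₁ g) w∈g simplicial = simplicial-endpoint g w∈g simplicial
  bi-simplicial-endpoint (inj₂ g) w∈g simplicial = swap (simplicial-endpoint g w∈g simplicial)

  module Chosen {S : Subset N} (c : PathChoice G S) where

    onPath-distinct : ∀ {u v w uS vS} → OnPath G c u v w uS vS → u ≢ v
    onPath-distinct (inj₁ (u<v , _)) refl = <-irrefl refl u<v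
    onPath-distinct (inj₂ (v<u , _)) refl = <-irrefl refl v<u

    onPath-common : ∀ {u v w w' uS vS} → OnPath G c u v w uS vS → OnPath G c u v w' uS vS →
                    Σ[ g ∈ BiGeodesic u v ] w ∈ biVerts g × w' ∈ biVerts g
    onPath-common {u} {v} {w' = w'} {uS} {vS} (inj₁ (u<v , w∈g)) (inj₁ (u<v' , w'∈g)) =
      inj₁ (path c u v u<v uS vS) , w∈g ,
      subst (λ h → w' ∈ geoVerts G (path c u v h uS vS)) (<-irrelevant u<v' u<v) w'∈g
    onPath-common {u} {v} {w' = w'} {uS} {vS} (inj₂ (v<u , w∈g)) (inj₂ (v<u' , w'∈g)) =
      inj₂ (path c v u v<u vS uS) , w∈g ,
      subst (λ h → w' ∈ geoVerts G (path c v u h vS uS)) (<-irrelevant v<u' v<u) w'∈g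
    onPath-common (inj₁ (u<v , _)) (inj₂ (v<u , _)) = ⊥-elim (<-asym u<v v<u)
    onPath-common (inj₂ (v<u , _)) (inj₁ (u<v , _)) = ⊥-elim (<-asym u<v v<u)

    onPath-geodesic : ∀ {u v w uS vS} → OnPath G c u v w uS vS → Σ[ g ∈ BiGeodesic u v ] w ∈ biVerts g
    onPath-geodesic op with onPath-common op op
    ... | g , w∈g , _ = g , w∈g

    onPath-all : ∀ {u v w} (uS : u ∈ₛ S) (vS : v ∈ₛ S) → u ≢ v →
                 (∀ (g : BiGeodesic u v) → w ∈ biVerts g) → OnPath G c u v w uS vS
    onPath-all {u} {v} uS vS u≢v on-all with <-cmp (toℕ u) (toℕ v)
    ... | tri< u<v _ _ = inj₁ (u<v , on-all (inj₁ (path c u v u<v uS vS)))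
    ... | tri≈ _ u≡v _ = ⊥-elim (u≢v (toℕ-injective u≡v))
    ... | tri> _ _ v<u = inj₂ (v<u , on-all (inj₂ (path c v u v<u vS uS)))

    onPath-left : ∀ {u v} (uS : u ∈ₛ S) (vS : v ∈ₛ S) → u ≢ v → OnPath G c u v u uS vS
    onPath-left uS vS u≢v = onPath-all uS vS u≢v λ
      { (inj₁ (_ , p , _)) → start∈verts p
      ; (inj₂ (_ , p , _)) → end∈verts p }

    onPath-right : ∀ {u v} (uS : u ∈ₛ S) (vS : v ∈ₛ S) → u ≢ v → OnPath G c u v v uS vS
    onPath-right uS vS u≢v = onPath-all uS vS u≢v λ
      { (inj₁ (_ , p , _)) → end∈verts p
      ; (inj₂ (_ , p , _)) → start∈verts p }

    covers-mono : ∀ {X Y} → X ⊆ Y → Covers G c X → Covers G c Y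
    covers-mono X⊆Y cov w with cov w
    ... | u , v , u∈X , rest = u , v , X⊆Y u∈X , rest

    -- A covered simplicial vertex is never inside a geodesic, so it must be
    -- an endpoint of its covering pair and belong to S.
    covered-simplicial : ∀ {X w} → Covers G c X → Simplicial w → w ∈ₛ S
    covered-simplicial {w = w} cov simplicial with cov w
    ... | u , v , _ , uS , vS , op with onPath-geodesic op
    ...   | g , w∈g with bi-simplicial-endpoint g w∈g simplicial
    ...     | inj₁ refl = uS
    ...     | inj₂ refl = vS

module HatGraph (n m : ℕ) (i₀ : Fin n) (j₀ : Fin m) where

  open import Data.Nat using (_+_; _*_; _≤_)
  open import Data.Nat.Properties using (<⇒≱; <-irrefl; +-identityʳ)
  open import Data.Bool using (Bool; true; false)
  open import Data.Fin using (toℕ; splitAt; combine; _↑ˡ_; _↑ʳ_; _≟_)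
  open import Data.Fin.Properties using (splitAt-↑ˡ; splitAt-↑ʳ; splitAt⁻¹-↑ˡ; splitAt⁻¹-↑ʳ;
                                         remQuot-combine; combine-remQuot)
  open import Data.Fin.Subset using (Subset; _∈_; _∉_; _⊆_; ∣_∣)
  open import Data.Fin.Subset.Properties using (_∈?_; ∣⊤∣≡n; ∣⊥∣≡0; p⊆q⇒∣p∣≤∣q∣; p⊂q⇒∣p∣<∣q∣)
  open import Data.Vec using (lookup; replicate; _++_)
  open import Data.Vec.Properties using (lookup-++ˡ; lookup-++ʳ; lookup-replicate; []=⇒lookup; lookup⇒[]=)
  open import Data.List using (List; []; _∷_; length; map; filter; cartesianProduct; allFin)
                                   renaming (_++_ to _++ₗ_)
  open import Data.List.Properties using (length-++; length-map)
  open import Data.List.Membership.Propositional.Properties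
    using (∈-map⁺; ∈-map⁻; ∈-++⁺ˡ; ∈-++⁺ʳ; ∈-++⁻; ∈-filter⁺; ∈-filter⁻; ∈-allFin;
           ∈-cartesianProduct⁺; ∈-cartesianProduct⁻)
  open import Data.List.Relation.Unary.Unique.Propositional using (Unique)
  import Data.List.Relation.Unary.Unique.Propositional.Properties as Unique
  open import Data.Product.Properties using () renaming (≡-dec to ×-≡-dec)
  open import Data.List.Relation.Unary.Any using (here; there)
  import Data.List.Membership.Propositional as List
  open import Data.Product using (Σ; ∃-syntax; _×_; _,_; proj₁; proj₂; uncurry)
  open import Data.Sum using (_⊎_; inj₁; inj₂; swap)
  import Data.Sum as Sum
  open import Data.Empty using (⊥; ⊥-elim)
  open import Function using (_∘_; id)
  open import Relation.Binary.PropositionalEquality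
  open import Relation.Nullary using (¬_; Dec; yes; no; ¬?)
  open import Data.Vec.Properties.WithK using ([]=-irrelevant)

  open Counting

  G : Graph
  G = SubdivHat n m

  open Graph G using (Adj)
  open GraphFacts G

  Vertex : Set
  Vertex = Fin (numVerts n m)

  enc : Kind n m → Vertex
  enc (a i)   = (i ↑ˡ m) ↑ˡ (n * m)
  enc (b j)   = (n ↑ʳ j) ↑ˡ (n * m)
  enc (s i j) = (n + m) ↑ʳ combine i j

  kind-enc : ∀ k → kind n m (enc k) ≡ k
  kind-enc (a i)   rewrite splitAt-↑ˡ (n + m) (i ↑ˡ m) (n * m) | splitAt-↑ˡ n i m = refl
  kind-enc (b j)   rewrite splitAt-↑ˡ (n + m) (n ↑ʳ j) (n * m) | splitAt-↑ʳ n m j = refl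
  kind-enc (s i j) rewrite splitAt-↑ʳ (n + m) (n * m) (combine i j) = cong (uncurry s) (remQuot-combine {n} {m} i j)

  enc-kind : ∀ x → enc (kind n m x) ≡ x
  enc-kind x with splitAt (n + m) x in split
  ... | inj₂ e = trans (cong ((n + m) ↑ʳ_) (combine-remQuot {n} m e)) (splitAt⁻¹-↑ʳ split)
  enc-kind x | inj₁ v with splitAt n v in split'
  ...   | inj₁ i = trans (cong (_↑ˡ (n * m)) (splitAt⁻¹-↑ˡ split')) (splitAt⁻¹-↑ˡ split)
  ...   | inj₂ j = trans (cong (_↑ˡ (n * m)) (splitAt⁻¹-↑ʳ split')) (splitAt⁻¹-↑ˡ split)

  enc-injective : ∀ {k l} → enc k ≡ enc l → k ≡ l
  enc-injective {k} {l} e = trans (sym (kind-enc k)) (trans (cong (kind n m) e) (kind-enc l))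

  s-injective : ∀ {i i' j j'} → enc (s i j) ≡ enc (s i' j') → i ≡ i' × j ≡ j'
  s-injective {i} {i'} {j} {j'} e with refl ← enc-injective {s i j} {s i' j'} e = refl , refl

  data View : Vertex → Set where
    vertex-a : ∀ i   → View (enc (a i))
    vertex-b : ∀ j   → View (enc (b j))
    vertex-s : ∀ i j → View (enc (s i j))

  view : ∀ x → View x
  view x = subst View (enc-kind x) (view-kind (kind n m x))
    where
    view-kind : ∀ k → View (enc k)
    view-kind (a i)   = vertex-a i
    view-kind (b j)   = vertex-b j
    view-kind (s i j) = vertex-s i j

  data Branch : Vertex → Set where
    branch-a : ∀ i → Branch (enc (a i))
    branch-b : ∀ j → Branch (enc (b j))

  branch≢sub : ∀ {x i j} → Branch x → x ≢ enc (s i j)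
  branch≢sub {i = i} {j} (branch-a i') e with () ← enc-injective {a i'} {s i j} e
  branch≢sub {i = i} {j} (branch-b j') e with () ← enc-injective {b j'} {s i j} e

  adj : ∀ k l → KAdj k l → Adj (enc k) (enc l)
  adj k l = subst₂ KAdj (sym (kind-enc k)) (sym (kind-enc l))

  adj⁻ : ∀ k l → Adj (enc k) (enc l) → KAdj k l
  adj⁻ k l = subst₂ KAdj (kind-enc k) (kind-enc l)

  adj-sym : ∀ {x y} → Adj x y → Adj y x
  adj-sym {x} {y} = kadj-sym (kind n m x) (kind n m y)
    where
    kadj-sym : ∀ k l → KAdj k l → KAdj l k
    kadj-sym (a _)   (s _ _) e = e
    kadj-sym (b _)   (s _ _) e = e
    kadj-sym (s _ _) (a _)   e = e
    kadj-sym (s _ _) (b _)   e = e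
    kadj-sym (s _ _) (s _ _) distinct (i≡i' , j≡j') = distinct (sym i≡i' , sym j≡j')

  neighbour-a : ∀ {i z} → Adj (enc (a i)) z → ∃[ j ] z ≡ enc (s i j)
  neighbour-a {i} {z} az with view z
  ... | vertex-a i'    = ⊥-elim (adj⁻ (a i) (a i') az)
  ... | vertex-b j     = ⊥-elim (adj⁻ (a i) (b j) az)
  ... | vertex-s i' j with refl ← adj⁻ (a i) (s i' j) az = j , refl

  neighbour-b : ∀ {j z} → Adj (enc (b j)) z → ∃[ i ] z ≡ enc (s i j)
  neighbour-b {j} {z} bz with view z
  ... | vertex-a i     = ⊥-elim (adj⁻ (b j) (a i) bz)
  ... | vertex-b j'    = ⊥-elim (adj⁻ (b j) (b j') bz)
  ... | vertex-s i j' with refl ← adj⁻ (b j) (s i j') bz = i , refl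

  branch-nonadjacent : ∀ {x y} → Branch x → Branch y → ¬ Adj x y
  branch-nonadjacent (branch-a i) (branch-a i') = adj⁻ (a i) (a i')
  branch-nonadjacent (branch-a i) (branch-b j)  = adj⁻ (a i) (b j)
  branch-nonadjacent (branch-b j) (branch-a i)  = adj⁻ (b j) (a i)
  branch-nonadjacent (branch-b j) (branch-b j') = adj⁻ (b j) (b j')

  branch-simplicial : ∀ {w} → Branch w → Simplicial w
  branch-simplicial (branch-a i) uw wv with neighbour-a (adj-sym uw) | neighbour-a wv
  ... | j , refl | j' , refl with j ≟ j'
  ...   | yes refl = inj₁ refl
  ...   | no  j≢j' = inj₂ (adj (s i j) (s i j') (λ (_ , j≡j') → j≢j' j≡j'))
  branch-simplicial (branch-b j) uw wv with neighbour-b (adj-sym uw) | neighbour-b wv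
  ... | i , refl | i' , refl with i ≟ i'
  ...   | yes refl = inj₁ refl
  ...   | no  i≢i' = inj₂ (adj (s i j) (s i' j) (λ (i≡i' , _) → i≢i' i≡i'))

  a-injective : ∀ {i i'} → enc (a i) ≡ enc (a i') → i ≡ i'
  a-injective {i} {i'} e with refl ← enc-injective {a i} {a i'} e = refl

  b-injective : ∀ {j j'} → enc (b j) ≡ enc (b j') → j ≡ j'
  b-injective {j} {j'} e with refl ← enc-injective {b j} {b j'} e = refl

  a≢b : ∀ {i j} → enc (a i) ≢ enc (b j)
  a≢b {i} {j} e with () ← enc-injective {a i} {b j} e

  walk-ab : ∀ i j → Walk G (enc (a i)) (enc (b j)) 2
  walk-ab i j = step (adj (a i) (s i j) refl) (step (adj (s i j) (b j) refl) here)

  walk-ba : ∀ i j → Walk G (enc (b j)) (enc (a i)) 2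
  walk-ba i j = step (adj (b j) (s i j) refl) (step (adj (s i j) (a i) refl) here)

  walk-aa : ∀ {i i'} → i ≢ i' → Walk G (enc (a i)) (enc (a i')) 3
  walk-aa {i} {i'} i≢i' =
    step (adj (a i) (s i j₀) refl)
      (step (adj (s i j₀) (s i' j₀) (i≢i' ∘ proj₁)) (step (adj (s i' j₀) (a i') refl) here))

  walk-bb : ∀ {j j'} → j ≢ j' → Walk G (enc (b j)) (enc (b j')) 3
  walk-bb {j} {j'} j≢j' =
    step (adj (b j) (s i₀ j) refl)
      (step (adj (s i₀ j) (s i₀ j') (j≢j' ∘ proj₂)) (step (adj (s i₀ j') (b j') refl) here))

  branch-walk≥2 : ∀ {x y k} → Branch x → Branch y → x ≢ y → Walk G x y k → 2 ≤ k
  branch-walk≥2 bx by x≢y = walk≥2 x≢y (branch-nonadjacent bx by)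

  -- Two vertices on the same side have no common neighbour.
  aa-walk≥3 : ∀ {i i' k} → i ≢ i' → Walk G (enc (a i)) (enc (a i')) k → 3 ≤ k
  aa-walk≥3 {i} {i'} i≢i' = walk≥3 (i≢i' ∘ a-injective) (branch-nonadjacent (branch-a i) (branch-a i')) no-common
    where
    no-common : ∀ {z} → Adj (enc (a i)) z → Adj z (enc (a i')) → ⊥
    no-common az za' with neighbour-a az | neighbour-a (adj-sym za')
    ... | _ , refl | _ , e = i≢i' (proj₁ (s-injective e))

  bb-walk≥3 : ∀ {j j' k} → j ≢ j' → Walk G (enc (b j)) (enc (b j')) k → 3 ≤ k
  bb-walk≥3 {j} {j'} j≢j' = walk≥3 (j≢j' ∘ b-injective) (branch-nonadjacent (branch-b j) (branch-b j')) no-common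
    where
    no-common : ∀ {z} → Adj (enc (b j)) z → Adj z (enc (b j')) → ⊥
    no-common bz zb' with neighbour-b bz | neighbour-b (adj-sym zb')
    ... | _ , refl | _ , e = j≢j' (proj₂ (s-injective e))

  branch-geodesic : ∀ {x y} → Branch x → Branch y → x ≢ y → Geodesic G x y
  branch-geodesic (branch-a i) (branch-a i') x≢y = geodesic (walk-aa i≢i') (aa-walk≥3 i≢i')
    where
    i≢i' : i ≢ i'
    i≢i' i≡i' = x≢y (cong (enc ∘ a) i≡i')
  branch-geodesic (branch-b j) (branch-b j') x≢y = geodesic (walk-bb j≢j') (bb-walk≥3 j≢j')
    where
    j≢j' : j ≢ j'
    j≢j' j≡j' = x≢y (cong (enc ∘ b) j≡j')
  branch-geodesic bx@(branch-a i) by@(branch-b j) x≢y = geodesic (walk-ab i j) (branch-walk≥2 bx by x≢y)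
  branch-geodesic bx@(branch-b j) by@(branch-a i) x≢y = geodesic (walk-ba i j) (branch-walk≥2 bx by x≢y)

  ab-geodesic : ∀ {i j} (g : Geodesic G (enc (a i)) (enc (b j))) →
                geoVerts G g ≡ enc (a i) ∷ enc (s i j) ∷ enc (b j) ∷ []
  ab-geodesic {i} {j} g with two-step g (geodesic-length (walk-ab i j) (branch-walk≥2 (branch-a i) (branch-b j) a≢b) g)
  ... | _ , az , zb , verts≡ with neighbour-a az | neighbour-b (adj-sym zb)
  ...   | _ , refl | _ , e with refl , refl ← s-injective e = verts≡

  ba-geodesic : ∀ {i j} (g : Geodesic G (enc (b j)) (enc (a i))) →
                geoVerts G g ≡ enc (b j) ∷ enc (s i j) ∷ enc (a i) ∷ []
  ba-geodesic {i} {j} g with two-step g (geodesic-length (walk-ba i j) (branch-walk≥2 (branch-b j) (branch-a i) (a≢b ∘ sym)) g)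
  ... | _ , bz , za , verts≡ with neighbour-b bz | neighbour-a (adj-sym za)
  ...   | _ , refl | _ , e with refl , refl ← s-injective e = verts≡

  aa-geodesic : ∀ {i i'} → i ≢ i' → (g : Geodesic G (enc (a i)) (enc (a i'))) →
                ∃[ j ] ∃[ j' ] geoVerts G g ≡ enc (a i) ∷ enc (s i j) ∷ enc (s i' j') ∷ enc (a i') ∷ []
  aa-geodesic i≢i' g with three-step g (geodesic-length (walk-aa i≢i') (aa-walk≥3 i≢i') g)
  ... | _ , _ , az₁ , z₂a , verts≡ with neighbour-a az₁ | neighbour-a (adj-sym z₂a)
  ...   | j , refl | j' , refl = j , j' , verts≡

  bb-geodesic : ∀ {j j'} → j ≢ j' → (g : Geodesic G (enc (b j)) (enc (b j'))) →
                ∃[ i ] ∃[ i' ] geoVerts G g ≡ enc (b j) ∷ enc (s i j) ∷ enc (s i' j') ∷ enc (b j') ∷ []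
  bb-geodesic j≢j' g with three-step g (geodesic-length (walk-bb j≢j') (bb-walk≥3 j≢j') g)
  ... | _ , _ , bz₁ , z₂b , verts≡ with neighbour-b bz₁ | neighbour-b (adj-sym z₂b)
  ...   | i , refl | i' , refl = i , i' , verts≡

  sub∈three : ∀ {x z y i j} → Branch x → Branch y → enc (s i j) List.∈ x ∷ z ∷ y ∷ [] → enc (s i j) ≡ z
  sub∈three bx _  (here e)                 = ⊥-elim (branch≢sub bx (sym e))
  sub∈three _  _  (there (here e))         = e
  sub∈three _  by (there (there (here e))) = ⊥-elim (branch≢sub by (sym e))

  sub∈four : ∀ {x z₁ z₂ y i j} → Branch x → Branch y → enc (s i j) List.∈ x ∷ z₁ ∷ z₂ ∷ y ∷ [] →
             enc (s i j) ≡ z₁ ⊎ enc (s i j) ≡ z₂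
  sub∈four bx _  (here e)                         = ⊥-elim (branch≢sub bx (sym e))
  sub∈four _  _  (there (here e))                 = inj₁ e
  sub∈four _  _  (there (there (here e)))         = inj₂ e
  sub∈four _  by (there (there (there (here e)))) = ⊥-elim (branch≢sub by (sym e))

  on-ab : ∀ {r c i j} (g : BiGeodesic (enc (a r)) (enc (b c))) → enc (s i j) List.∈ biVerts g → i ≡ r × j ≡ c
  on-ab (inj₁ g) s∈g =
    s-injective (sub∈three (branch-a _) (branch-b _) (subst (_ List.∈_) (ab-geodesic g) s∈g))
  on-ab (inj₂ g) s∈g =
    s-injective (sub∈three (branch-b _) (branch-a _) (subst (_ List.∈_) (ba-geodesic g) s∈g))

  on-ba : ∀ {r c i j} (g : BiGeodesic (enc (b c)) (enc (a r))) → enc (s i j) List.∈ biVerts g → i ≡ r × j ≡ c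
  on-ba g s∈g = on-ab (swap g) (bi-swap g s∈g)
    where
    bi-swap : ∀ {u v w} (g : BiGeodesic u v) → w List.∈ biVerts g → w List.∈ biVerts (swap g)
    bi-swap (inj₁ _) w∈g = w∈g
    bi-swap (inj₂ _) w∈g = w∈g

  on-aa : ∀ {r r'} → r ≢ r' → (g : BiGeodesic (enc (a r)) (enc (a r'))) →
          ∃[ j₁ ] ∃[ j₂ ] ∀ {i j} → enc (s i j) List.∈ biVerts g → (i ≡ r × j ≡ j₁) ⊎ (i ≡ r' × j ≡ j₂)
  on-aa r≢r' (inj₁ g) with aa-geodesic r≢r' g
  ... | j₁ , j₂ , verts≡ = j₁ , j₂ , λ s∈g →
        Sum.map s-injective s-injective (sub∈four (branch-a _) (branch-a _) (subst (_ List.∈_) verts≡ s∈g))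
  on-aa r≢r' (inj₂ g) with aa-geodesic (r≢r' ∘ sym) g
  ... | j₂ , j₁ , verts≡ = j₁ , j₂ , λ s∈g →
        swap (Sum.map s-injective s-injective (sub∈four (branch-a _) (branch-a _) (subst (_ List.∈_) verts≡ s∈g)))

  on-bb : ∀ {c c'} → c ≢ c' → (g : BiGeodesic (enc (b c)) (enc (b c'))) →
          ∃[ i₁ ] ∃[ i₂ ] ∀ {i j} → enc (s i j) List.∈ biVerts g → (i ≡ i₁ × j ≡ c) ⊎ (i ≡ i₂ × j ≡ c')
  on-bb c≢c' (inj₁ g) with bb-geodesic c≢c' g
  ... | i₁ , i₂ , verts≡ = i₁ , i₂ , λ s∈g →
        Sum.map s-injective s-injective (sub∈four (branch-b _) (branch-b _) (subst (_ List.∈_) verts≡ s∈g))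
  on-bb c≢c' (inj₂ g) with bb-geodesic (c≢c' ∘ sym) g
  ... | i₂ , i₁ , verts≡ = i₁ , i₂ , λ s∈g →
        swap (Sum.map s-injective s-injective (sub∈four (branch-b _) (branch-b _) (subst (_ List.∈_) verts≡ s∈g)))

  aa-row-unique : ∀ {r r' i j j'} → r ≢ r' → (g : BiGeodesic (enc (a r)) (enc (a r'))) →
                  enc (s i j) List.∈ biVerts g → enc (s i j') List.∈ biVerts g → j ≡ j'
  aa-row-unique r≢r' g s∈g s'∈g with on-aa r≢r' g
  ... | _ , _ , rows with rows s∈g | rows s'∈g
  ...   | inj₁ (_ , refl)    | inj₁ (_ , refl)    = refl
  ...   | inj₂ (_ , refl)    | inj₂ (_ , refl)    = refl
  ...   | inj₁ (refl , _)    | inj₂ (refl , _)    = ⊥-elim (r≢r' refl)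
  ...   | inj₂ (refl , _)    | inj₁ (refl , _)    = ⊥-elim (r≢r' refl)

  bb-column-unique : ∀ {c c' i i' j} → c ≢ c' → (g : BiGeodesic (enc (b c)) (enc (b c'))) →
                     enc (s i j) List.∈ biVerts g → enc (s i' j) List.∈ biVerts g → i ≡ i'
  bb-column-unique c≢c' g s∈g s'∈g with on-bb c≢c' g
  ... | _ , _ , columns with columns s∈g | columns s'∈g
  ...   | inj₁ (refl , _)    | inj₁ (refl , _)    = refl
  ...   | inj₂ (refl , _)    | inj₂ (refl , _)    = refl
  ...   | inj₁ (_ , refl)    | inj₂ (_ , refl)    = ⊥-elim (c≢c' refl)
  ...   | inj₂ (_ , refl)    | inj₁ (_ , refl)    = ⊥-elim (c≢c' refl)

  classes : Bool → Bool → Bool → Subset (numVerts n m)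
  classes α β γ = (replicate n α ++ replicate m β) ++ replicate (n * m) γ

  selects : Bool → Bool → Bool → Kind n m → Bool
  selects α _ _ (a _)   = α
  selects _ β _ (b _)   = β
  selects _ _ γ (s _ _) = γ

  lookup-classes : ∀ α β γ k → lookup (classes α β γ) (enc k) ≡ selects α β γ k
  lookup-classes α β γ (a i) = begin
    lookup ((replicate n α ++ replicate m β) ++ replicate (n * m) γ) ((i ↑ˡ m) ↑ˡ (n * m))
      ≡⟨ lookup-++ˡ (replicate n α ++ replicate m β) (replicate (n * m) γ) (i ↑ˡ m) ⟩
    lookup (replicate n α ++ replicate m β) (i ↑ˡ m)  ≡⟨ lookup-++ˡ (replicate n α) (replicate m β) i ⟩
    lookup (replicate n α) i                          ≡⟨ lookup-replicate i α ⟩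
    α ∎
    where open ≡-Reasoning
  lookup-classes α β γ (b j) = begin
    lookup ((replicate n α ++ replicate m β) ++ replicate (n * m) γ) ((n ↑ʳ j) ↑ˡ (n * m))
      ≡⟨ lookup-++ˡ (replicate n α ++ replicate m β) (replicate (n * m) γ) (n ↑ʳ j) ⟩
    lookup (replicate n α ++ replicate m β) (n ↑ʳ j)  ≡⟨ lookup-++ʳ (replicate n α) (replicate m β) j ⟩
    lookup (replicate m β) j                          ≡⟨ lookup-replicate j β ⟩
    β ∎
    where open ≡-Reasoning
  lookup-classes α β γ (s i j) =
    trans (lookup-++ʳ (replicate n α ++ replicate m β) (replicate (n * m) γ) (combine i j))
          (lookup-replicate (combine i j) γ)

  ∈-classes : ∀ {α β γ} k → selects α β γ k ≡ true → enc k ∈ classes α β γ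
  ∈-classes {α} {β} {γ} k selected =
    lookup⇒[]= (enc k) (classes α β γ) (trans (lookup-classes α β γ k) selected)

  classes-∈ : ∀ {α β γ} k → enc k ∈ classes α β γ → selects α β γ k ≡ true
  classes-∈ {α} {β} {γ} k k∈ = trans (sym (lookup-classes α β γ k)) ([]=⇒lookup k∈)

  BranchSet SideA : Subset (numVerts n m)
  BranchSet = classes true true false
  SideA     = classes true false false

  branch∈ : ∀ {x} → Branch x → x ∈ BranchSet
  branch∈ (branch-a i) = ∈-classes (a i) refl
  branch∈ (branch-b j) = ∈-classes (b j) refl

  sub∉branch : ∀ {i j} → enc (s i j) ∉ BranchSet
  sub∉branch {i} {j} s∈ with () ← classes-∈ (s i j) s∈

  ∈branch : ∀ {x} → x ∈ BranchSet → Branch x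
  ∈branch {x} x∈ with view x
  ... | vertex-a i   = branch-a i
  ... | vertex-b j   = branch-b j
  ... | vertex-s i j = ⊥-elim (sub∉branch x∈)

  a∈sideA : ∀ i → enc (a i) ∈ SideA
  a∈sideA i = ∈-classes (a i) refl

  sideA⊆branch : SideA ⊆ BranchSet
  sideA⊆branch {x} x∈ with view x
  ... | vertex-a i   = branch∈ (branch-a i)
  ... | vertex-b j   with () ← classes-∈ (b j) x∈
  ... | vertex-s i j with () ← classes-∈ (s i j) x∈

  ∣sideA∣ : ∣ SideA ∣ ≡ n
  ∣sideA∣ = begin
    ∣ (replicate n true ++ replicate m false) ++ replicate (n * m) false ∣
      ≡⟨ ∣++∣ (replicate n true ++ replicate m false) (replicate (n * m) false) ⟩
    ∣ replicate n true ++ replicate m false ∣ + ∣ replicate (n * m) false ∣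
      ≡⟨ cong₂ _+_ (∣++∣ (replicate n true) (replicate m false)) (∣⊥∣≡0 (n * m)) ⟩
    (∣ replicate n true ∣ + ∣ replicate m false ∣) + 0
      ≡⟨ cong₂ _+_ (cong₂ _+_ (∣⊤∣≡n n) (∣⊥∣≡0 m)) refl ⟩
    (n + 0) + 0
      ≡⟨ trans (+-identityʳ (n + 0)) (+-identityʳ n) ⟩
    n ∎
    where open ≡-Reasoning

  branch-choice : PathChoice G BranchSet
  branch-choice = record
    { path = λ x y x<y x∈ y∈ →
        branch-geodesic (∈branch x∈) (∈branch y∈) (λ x≡y → <-irrefl (cong toℕ x≡y) x<y) }

  module Upper = Chosen branch-choice

  sideA-covers : Covers G branch-choice SideA
  sideA-covers w with view w
  ... | vertex-a i   = enc (a i) , enc (b j₀) , a∈sideA i , branch∈ (branch-a i) , branch∈ (branch-b j₀) ,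
                       Upper.onPath-left _ _ a≢b
  ... | vertex-b j   = enc (a i₀) , enc (b j) , a∈sideA i₀ , branch∈ (branch-a i₀) , branch∈ (branch-b j) ,
                       Upper.onPath-right _ _ a≢b
  ... | vertex-s i j = enc (a i) , enc (b j) , a∈sideA i , branch∈ (branch-a i) , branch∈ (branch-b j) ,
                       Upper.onPath-all _ _ a≢b s∈geodesic
    where
    s∈geodesic : ∀ (g : BiGeodesic (enc (a i)) (enc (b j))) → enc (s i j) List.∈ biVerts g
    s∈geodesic (inj₁ g) = subst (enc (s i j) List.∈_) (sym (ab-geodesic g)) (there (here refl))
    s∈geodesic (inj₂ g) = subst (enc (s i j) List.∈_) (sym (ba-geodesic g)) (there (here refl))

  sideA-core : IsStrongGeodeticCore G BranchSet SideA
  sideA-core = sideA⊆branch , branch-choice , sideA-covers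

  -- Branch vertices are simplicial, so every strong geodetic set contains them.
  branch⊆ : ∀ {S X} (c : PathChoice G S) → Covers G c X → BranchSet ⊆ S
  branch⊆ c cov x∈ = Chosen.covered-simplicial c cov (branch-simplicial (∈branch x∈))

  branch-sg-set : IsSgSet G BranchSet
  branch-sg-set = (branch-choice , Upper.covers-mono sideA⊆branch sideA-covers) ,
                  λ S (c , cov) → p⊆q⇒∣p∣≤∣q∣ (branch⊆ c cov)

  -- Conversely an sg-set has no subdivision vertex: it would strictly contain BranchSet.
  sg-set⊆branch : ∀ {S} → IsSgSet G S → S ⊆ BranchSet
  sg-set⊆branch ((c , cov) , minimal) {x} x∈S with view x
  ... | vertex-a i   = branch∈ (branch-a i)
  ... | vertex-b j   = branch∈ (branch-b j)
  ... | vertex-s i j = ⊥-elim (<⇒≱ (p⊂q⇒∣p∣<∣q∣ (branch⊆ c cov , enc (s i j) , x∈S , sub∉branch))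
                                    (minimal BranchSet (proj₁ branch-sg-set)))

  -- For a core X of an sg-set S, let p, q count the a's and b's
  -- in X and r, c those missing from X.  Each of the r·c vertices s_ij with
  -- a_i, b_j ∉ X is covered by a distinct pair (a_r', a_i) or (b_c', b_j) with
  -- the first vertex in X, and there are p·r + q·c such pairs.
  record CoreCensus (X : Subset (numVerts n m)) : Set where
    field
      p q r c : ℕ
      sides-a : p + r ≡ n
      sides-b : q + c ≡ m
      pairs   : r * c ≤ p * r + q * c
      in-core : p + q ≤ ∣ X ∣

  module Census {S X : Subset (numVerts n m)} (S⊆branch : S ⊆ BranchSet)
                (paths : PathChoice G S) (cov : Covers G paths X) where

    open Chosen paths

    classify : ∀ {u v i j} {uS : u ∈ S} {vS : v ∈ S} → u ∈ X → enc (a i) ∉ X → enc (b j) ∉ X →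
               OnPath G paths u v (enc (s i j)) uS vS →
               (∃[ r ] u ≡ enc (a r) × v ≡ enc (a i)) ⊎ (∃[ c ] u ≡ enc (b c) × v ≡ enc (b j))
    classify {uS = uS} {vS} u∈X a∉X b∉X op
      with ∈branch (S⊆branch uS) | ∈branch (S⊆branch vS) | onPath-geodesic op | onPath-distinct op
    ... | branch-a r | branch-a r' | g , s∈g | u≢v with on-aa (u≢v ∘ cong (enc ∘ a)) g
    ...   | _ , _ , rows with rows s∈g
    ...     | inj₁ (refl , _) = ⊥-elim (a∉X u∈X)
    ...     | inj₂ (refl , _) = inj₁ (r , refl , refl)
    classify u∈X a∉X b∉X op | branch-a r | branch-b c | g , s∈g | _ with on-ab g s∈g
    ...   | refl , _ = ⊥-elim (a∉X u∈X)
    classify u∈X a∉X b∉X op | branch-b c | branch-a r | g , s∈g | _ with on-ba g s∈g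
    ...   | _ , refl = ⊥-elim (b∉X u∈X)
    classify u∈X a∉X b∉X op | branch-b c | branch-b c' | g , s∈g | u≢v with on-bb (u≢v ∘ cong (enc ∘ b)) g
    ...   | _ , _ , columns with columns s∈g
    ...     | inj₁ (_ , refl) = ⊥-elim (b∉X u∈X)
    ...     | inj₂ (_ , refl) = inj₂ (c , refl , refl)

    pair-determines : ∀ {u v i j i' j'} {uS : u ∈ S} {vS : v ∈ S} {uS' vS'} → u ∈ X →
                      enc (a i) ∉ X → enc (b j) ∉ X → enc (a i') ∉ X → enc (b j') ∉ X →
                      OnPath G paths u v (enc (s i j)) uS vS → OnPath G paths u v (enc (s i' j')) uS' vS' →
                      (i , j) ≡ (i' , j')
    pair-determines {uS = uS} {vS} {uS'} {vS'} u∈X a∉X b∉X a'∉X b'∉X op op'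
      with refl ← []=-irrelevant uS uS' | refl ← []=-irrelevant vS vS'
      with classify u∈X a∉X b∉X op | classify u∈X a'∉X b'∉X op' | onPath-common op op' | onPath-distinct op
    ... | inj₁ (_ , refl , refl) | inj₁ (_ , _ , v≡) | g , s∈g , s'∈g | u≢v with refl ← a-injective v≡ =
      cong (_ ,_) (aa-row-unique (u≢v ∘ cong (enc ∘ a)) g s∈g s'∈g)
    ... | inj₂ (_ , refl , refl) | inj₂ (_ , _ , v≡) | g , s∈g , s'∈g | u≢v with refl ← b-injective v≡ =
      cong (_, _) (bb-column-unique (u≢v ∘ cong (enc ∘ b)) g s∈g s'∈g)
    ... | inj₁ (_ , _ , refl) | inj₂ (_ , _ , v≡) | _ | _ = ⊥-elim (a≢b v≡)
    ... | inj₂ (_ , _ , refl) | inj₁ (_ , _ , v≡) | _ | _ = ⊥-elim (a≢b (sym v≡))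

    Witness : Vertex → Set
    Witness w = ∃[ u ] ∃[ v ] Σ (u ∈ X) λ _ → Σ (u ∈ S) λ uS → Σ (v ∈ S) λ vS → OnPath G paths u v w uS vS

    endpoints : ∀ {w} → Witness w → Vertex × Vertex
    endpoints (u , v , _) = u , v

    in-X-a? : (i : Fin n) → Dec (enc (a i) ∈ X)
    in-X-a? i = enc (a i) ∈? X

    in-X-b? : (j : Fin m) → Dec (enc (b j) ∈ X)
    in-X-b? j = enc (b j) ∈? X

    presentA absentA : List (Fin n)
    presentA = filter in-X-a? (allFin n)
    absentA  = filter (¬? ∘ in-X-a?) (allFin n)

    presentB absentB : List (Fin m)
    presentB = filter in-X-b? (allFin m)
    absentB  = filter (¬? ∘ in-X-b?) (allFin m)

    uncovered : List (Fin n × Fin m)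
    uncovered = cartesianProduct absentA absentB

    candidates : List (Vertex × Vertex)
    candidates = map (λ (r , i) → enc (a r) , enc (a i)) (cartesianProduct presentA absentA)
              ++ₗ map (λ (c , j) → enc (b c) , enc (b j)) (cartesianProduct presentB absentB)

    covering-pair : Fin n × Fin m → Vertex × Vertex
    covering-pair (i , j) = endpoints (cov (enc (s i j)))

    uncovered-absent : ∀ {i j} → (i , j) List.∈ uncovered → enc (a i) ∉ X × enc (b j) ∉ X
    uncovered-absent ij∈ with ∈-cartesianProduct⁻ absentA absentB ij∈
    ... | i∈ , j∈ = proj₂ (∈-filter⁻ (¬? ∘ in-X-a?) {xs = allFin n} i∈) ,
                    proj₂ (∈-filter⁻ (¬? ∘ in-X-b?) {xs = allFin m} j∈)

    endpoints∈candidates : ∀ {i j} (ω : Witness (enc (s i j))) → enc (a i) ∉ X → enc (b j) ∉ X →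
                           endpoints ω List.∈ candidates
    endpoints∈candidates {i} {j} (_ , _ , u∈X , _ , _ , op) a∉X b∉X with classify u∈X a∉X b∉X op
    ... | inj₁ (r , refl , refl) = ∈-++⁺ˡ (∈-map⁺ _ (∈-cartesianProduct⁺
            (∈-filter⁺ in-X-a? (∈-allFin r) u∈X) (∈-filter⁺ (¬? ∘ in-X-a?) (∈-allFin i) a∉X)))
    ... | inj₂ (c , refl , refl) = ∈-++⁺ʳ _ (∈-map⁺ _ (∈-cartesianProduct⁺
            (∈-filter⁺ in-X-b? (∈-allFin c) u∈X) (∈-filter⁺ (¬? ∘ in-X-b?) (∈-allFin j) b∉X)))

    endpoints-injective : ∀ {i j i' j'} (ω : Witness (enc (s i j))) (ω' : Witness (enc (s i' j'))) →
                          enc (a i) ∉ X × enc (b j) ∉ X → enc (a i') ∉ X × enc (b j') ∉ X →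
                          endpoints ω ≡ endpoints ω' → (i , j) ≡ (i' , j')
    endpoints-injective (_ , _ , u∈X , _ , _ , op) (_ , _ , _ , _ , _ , op') (a∉X , b∉X) (a'∉X , b'∉X) refl =
      pair-determines u∈X a∉X b∉X a'∉X b'∉X op op'

    pairs-bound : length uncovered ≤ length candidates
    pairs-bound = injection-length (×-≡-dec _≟_ _≟_) covering-pair
      (Unique.cartesianProduct⁺ (Unique.filter⁺ _ (Unique.allFin⁺ n)) (Unique.filter⁺ _ (Unique.allFin⁺ m)))
      (λ ij∈ ij'∈ → endpoints-injective (cov _) (cov _) (uncovered-absent ij∈) (uncovered-absent ij'∈))
      (λ ij∈ → uncurry (endpoints∈candidates (cov _)) (uncovered-absent ij∈))

    present : List Vertex
    present = map (enc ∘ a) presentA ++ₗ map (enc ∘ b) presentB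

    present-bound : length presentA + length presentB ≤ ∣ X ∣
    present-bound = subst₂ _≤_ length-present (length-members X)
      (injection-length _≟_ id unique-present (λ _ _ e → e) (∈-members ∘ present⊆X))
      where
      length-present : length present ≡ length presentA + length presentB
      length-present = trans (length-++ (map (enc ∘ a) presentA))
                             (cong₂ _+_ (length-map (enc ∘ a) presentA) (length-map (enc ∘ b) presentB))
      unique-present : Unique present
      unique-present = Unique.++⁺ (Unique.map⁺ a-injective (Unique.filter⁺ in-X-a? (Unique.allFin⁺ n)))
                                  (Unique.map⁺ b-injective (Unique.filter⁺ in-X-b? (Unique.allFin⁺ m)))
                                  disjoint
        where
        disjoint : ∀ {x} → ¬ (x List.∈ map (enc ∘ a) presentA × x List.∈ map (enc ∘ b) presentB)
        disjoint (x∈A , x∈B) with ∈-map⁻ (enc ∘ a) x∈A | ∈-map⁻ (enc ∘ b) x∈B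
        ... | _ , _ , refl | _ , _ , e = a≢b e
      present⊆X : ∀ {x} → x List.∈ present → x ∈ X
      present⊆X x∈ with ∈-++⁻ (map (enc ∘ a) presentA) x∈
      ... | inj₁ x∈A with ∈-map⁻ (enc ∘ a) x∈A
      ...   | i , i∈ , refl = proj₂ (∈-filter⁻ in-X-a? {xs = allFin n} i∈)
      present⊆X x∈ | inj₂ x∈B with ∈-map⁻ (enc ∘ b) x∈B
      ...   | j , j∈ , refl = proj₂ (∈-filter⁻ in-X-b? {xs = allFin m} j∈)

    core-census : CoreCensus X
    core-census = record
      { p = length presentA ; q = length presentB ; r = length absentA ; c = length absentB
      ; sides-a = length-filter-allFin in-X-a?
      ; sides-b = length-filter-allFin in-X-b?
      ; pairs   = subst₂ _≤_ (length-cartesianProduct absentA absentB) length-candidates pairs-bound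
      ; in-core = present-bound
      }
      where
      length-candidates : length candidates ≡
                          length presentA * length absentA + length presentB * length absentB
      length-candidates = trans (length-++ (map _ (cartesianProduct presentA absentA)))
        (cong₂ _+_
          (trans (length-map _ (cartesianProduct presentA absentA)) (length-cartesianProduct presentA absentA))
          (trans (length-map _ (cartesianProduct presentB absentB)) (length-cartesianProduct presentB absentB)))

  census : ∀ {S X} → IsSgSet G S → IsStrongGeodeticCore G S X → CoreCensus X
  census sg (_ , paths , cov) = Census.core-census (sg-set⊆branch sg) paths cov

open Arithmetic using (C2-positive; core-bound)

proposition4p1 : (n : ℕ) → 4 ≤ n → SgcEq (HatSG n) n
proposition4p1 0 ()
proposition4p1 1 (s≤s ())
proposition4p1 n@(suc (suc k)) 4≤n = (BranchSet , SideA , branch-sg-set , sideA-core , ∣sideA∣) , lower-bound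
  where
  open HatGraph n (n C 2) Fin.zero (fromℕ< (C2-positive k))

  lower-bound : ∀ S X → IsSgSet (HatSG n) S → IsStrongGeodeticCore (HatSG n) S X → n ≤ ∣ X ∣
  lower-bound S X sg-set core = ≤-trans (core-bound p q r c 4≤n sides-a sides-b pairs) in-core
    where open CoreCensus (census sg-set core)
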